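{- Let $S$ be a finite set and let $\mathcal{V}\le\mathcal{P}(S)$ have basis $\mathscr{X}=(X_1,\dots,X_r)$. Let $\vec a,\vec b\in\mathbb{F}_2^r$ with $v_{\mathscr{X}}(\vec a)$ nonempty. Then $v_{\mathscr{X}}(\vec a)\subseteq z_{\mathscr{X}}(\vec b)$ if and only if $\vec a\cdot\vec b=1$.
   Context: $\mathcal{P}(S)$ is an $\mathbb{F}_2$-vector space under symmetric difference $\triangle$. For $\vec a\in\mathbb{F}_2^r$ with support $I_{\vec a}=\{i:a_i=1\}$: $z_{\mathscr{X}}(\vec a)=\triangle_{i\in I_{\vec a}}X_i$ ($\varnothing$ if $\vec a=\vec 0$) and $v_{\mathscr{X}}(\vec a)=\bigcap_{i\in I_{\vec a}}X_i\cap\bigcap_{i\notin I_{\vec a}}(S\setminus X_i)$. The dot product is $\vec a\cdot\vec b=\sum_i a_ib_i\in\mathbb{F}_2$. -}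

module Defs where

open import Data.Nat using (ℕ)
open import Data.Bool using (Bool; true; false; _xor_; _∧_; if_then_else_)
open import Data.Vec using (Vec; []; _∷_; zipWith)
open import Data.Fin.Subset using (Subset; ⊥; ⊤; _∩_; ∁)
open import Relation.Binary.PropositionalEquality using (_≡_)

-- The finite set S is modelled as Fin n; P(S) is Subset n = Vec Bool n.
-- F₂ is modelled as Bool (true = 1, addition = xor, multiplication = ∧);
-- F₂^r is Vec Bool r.

infixl 6 _△_
_△_ : ∀ {n} → Subset n → Subset n → Subset n
_△_ = zipWith _xor_

z : ∀ {n r} → Vec (Subset n) r → Vec Bool r → Subset n
z []       []       = ⊥
z (X ∷ Xs) (a ∷ as) = (if a then X else ⊥) △ z Xs as

v : ∀ {n r} → Vec (Subset n) r → Vec Bool r → Subset n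
v []       []       = ⊤
v (X ∷ Xs) (a ∷ as) = (if a then X else ∁ X) ∩ v Xs as

0⃗ : ∀ {r} → Vec Bool r
0⃗ {ℕ.zero}  = []
0⃗ {ℕ.suc r} = false ∷ 0⃗

_·_ : ∀ {r} → Vec Bool r → Vec Bool r → Bool
[]       · []       = false
(a ∷ as) · (b ∷ bs) = (a ∧ b) xor (as · bs)

LinearlyIndependent : ∀ {n r} → Vec (Subset n) r → Set
LinearlyIndependent {n} {r} Xs = (c : Vec Bool r) → z Xs c ≡ ⊥ → c ≡ 0⃗

-- A point p of the atom v(a) lies in X_i exactly when a_i = 1, so p lies in
-- z(b) = △_{b_i = 1} X_i exactly when an odd number of indices have
-- a_i = b_i = 1, i.e. when a · b = 1. Both directions of the equivalence are
-- then read off at a single point of the nonempty atom.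
module Submission where

open import Defs
open import Data.Nat using (ℕ)
open import Data.Bool using (Bool; true; false; _∧_; _xor_; if_then_else_)
open import Data.Vec using (Vec; []; _∷_; lookup)
open import Data.Vec.Properties using (lookup-zipWith; lookup-replicate; []=⇒lookup; lookup⇒[]=)
open import Data.Fin using (Fin)
open import Data.Fin.Subset using (Subset; _∈_; _⊆_; Nonempty; ⊥; ∁)
open import Data.Fin.Subset.Properties using (x∈p∩q⁻; x∈∁p⇒x∉p)
open import Data.Product using (_×_; _,_)
open import Relation.Binary.PropositionalEquality using (_≡_; refl; sym; trans; cong₂)

private
  variable
    n r : ℕ

lookup-⊥ : (p : Fin n) → lookup (⊥ {n}) p ≡ false
lookup-⊥ p = lookup-replicate p false

lookup-△ : (s t : Subset n) (p : Fin n) → lookup (s △ t) p ≡ lookup s p xor lookup t p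
lookup-△ s t p = lookup-zipWith _xor_ p s t

∉⇒lookup≡false : {X : Subset n} {p : Fin n} → p ∈ ∁ X → lookup X p ≡ false
∉⇒lookup≡false {X = X} {p} p∈∁X with lookup X p in eq
... | false = refl
... | true  with () ← x∈∁p⇒x∉p p∈∁X (lookup⇒[]= p X eq)

lookup-select : (X : Subset n) (a b : Bool) {p : Fin n} → p ∈ (if a then X else ∁ X) →
                lookup (if b then X else ⊥) p ≡ a ∧ b
lookup-select X true  true  p∈X  = []=⇒lookup p∈X
lookup-select X true  false {p} _ = lookup-⊥ p
lookup-select X false false {p} _ = lookup-⊥ p
lookup-select X false true  p∈∁X = ∉⇒lookup≡false p∈∁X

lookup-z-on-v : (Xs : Vec (Subset n) r) (a b : Vec Bool r) {p : Fin n} →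
                p ∈ v Xs a → lookup (z Xs b) p ≡ a · b
lookup-z-on-v []       []       []       {p} _ = lookup-⊥ p
lookup-z-on-v (X ∷ Xs) (a ∷ as) (b ∷ bs) {p} p∈v
  with p∈X , p∈vs ← x∈p∩q⁻ (if a then X else ∁ X) (v Xs as) p∈v =
  trans (lookup-△ (if b then X else ⊥) (z Xs bs) p)
        (cong₂ _xor_ (lookup-select X a b p∈X) (lookup-z-on-v Xs as bs p∈vs))

lemma3p13 : (n r : ℕ) (Xs : Vec (Subset n) r) → LinearlyIndependent Xs →
    (a b : Vec Bool r) → Nonempty (v Xs a) →
    ((v Xs a ⊆ z Xs b → a · b ≡ true) × (a · b ≡ true → v Xs a ⊆ z Xs b))
lemma3p13 n r Xs _ a b (p , p∈v) = ⊆⇒·≡true , ·≡true⇒⊆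
  where
  ⊆⇒·≡true : v Xs a ⊆ z Xs b → a · b ≡ true
  ⊆⇒·≡true v⊆z = trans (sym (lookup-z-on-v Xs a b p∈v)) ([]=⇒lookup (v⊆z p∈v))

  ·≡true⇒⊆ : a · b ≡ true → v Xs a ⊆ z Xs b
  ·≡true⇒⊆ a·b≡true {q} q∈v =
    lookup⇒[]= q (z Xs b) (trans (lookup-z-on-v Xs a b q∈v) a·b≡true)
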